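{- Let $\mathcal P$ be a frame polyomino and $\mathcal R=\{R_1,\dots,R_k\}$ a $k$-rook configuration in $\mathcal P$. Then there exists a $k$-rook configuration $\mathcal C=\{R_1',\dots,R_k'\}$ in $\mathcal P$ with $\mathcal C\sim\mathcal R$ such that any two switching rooks $R_i',R_j'$ ($i\ne j$) of $\mathcal C$ are in diagonal position.
   Context: Intervals and cells. For $a=(i,j),b=(k,l)\in\mathbb Z^2$ write $a\le b$ if $i\le k$, $j\le l$; the interval is $[a,b]=\{(p,q): i\le p\le k,\ j\le q\le l\}$, proper if $i<k$, $j<l$, with diagonal corners $a,b$ and anti-diagonal corners $(i,l),(k,j)$. A cell is an interval $[a,a+(1,1)]$. A polyomino $\mathcal P$ is a finite nonempty edge-connected set of cells; for an interval $J$, $\mathcal P_J$ is the set of cells contained in $J$; a proper interval $J$ is an inner interval of $\mathcal P$ if $\mathcal P_J\subseteq\mathcal P$; the cells of $\mathcal P_J$ containing its diagonal corners are its diagonal cells, those containing its anti-diagonal corners its anti-diagonal cells. Frame polyominoes. A north-east path is a sequence of points of $\mathbb Z^2$ with consecutive differences $(1,0)$ or $(0,1)$. For paths $S_1:(a_0,b_0),\dots,(a_k,b_k)$ and $S_2:(c_0,d_0),\dots,(c_k,d_k)$ with common endpoints, $S_1$ lies above $S_2$ if $b_i>d_j$ whenever $a_i=c_j$, $1\le i,j\le k-1$; the parallelogram polyomino they determine is the set of cells in the region bounded above by $S_1$ and below by $S_2$. With $I=[(1,1),(m,n)]$ and $\mathcal S$ such a parallelogram polyomino with $1<a_0<a_k<m$,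 $1<b_0<b_k<n$, the frame polyomino is $\mathcal P=\mathcal P_I\setminus\mathcal S$. Rooks. Two distinct cells of $\mathcal P$ are in attacking position if their lower left corners lie on a common horizontal or vertical line and all cells between them on that line belong to $\mathcal P$. A $k$-rook configuration is a set of $k$ cells (rooks) of $\mathcal P$ pairwise not in attacking position. Two rooks of a configuration are switching if they are the two diagonal cells (diagonal position) or the two anti-diagonal cells (anti-diagonal position) of an inner interval $J$ of $\mathcal P$; a switch replaces them by the other two corner cells of $\mathcal P_J$, giving again a $k$-rook configuration. $\sim$ is the equivalence relation on $k$-rook configurations in which two configurations are equivalent iff one is obtained from the other by a finite sequence of switches. -}

module Defs where

open import Data.Nat using (ℕ; zero; suc; _+_; _∸_; _≤_; _<_; _⊔_; _⊓_)
open import Data.Fin using (Fin; toℕ; inject₁)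
import Data.Fin as Fin
open import Data.Product using (Σ; ∃; ∃-syntax; _×_; _,_; proj₁; proj₂)
open import Data.Sum using (_⊎_)
open import Relation.Nullary using (¬_)
open import Relation.Binary.PropositionalEquality using (_≡_; _≢_)
open import Relation.Binary.Construct.Closure.ReflexiveTransitive using (Star)

-- Points and cells.  All objects live in I = [(1,1),(m,n)], so natural
-- number coordinates suffice.  A cell [a, a+(1,1)] is identified with its
-- lower-left corner a.

Point : Set
Point = ℕ × ℕ

Cell : Set
Cell = ℕ × ℕ

CellSet : Set₁
CellSet = Cell → Set

EastStep : Point → Point → Set
EastStep (x , y) (x' , y') = (x' ≡ suc x) × (y' ≡ y)

NorthStep : Point → Point → Set
NorthStep (x , y) (x' , y') = (x' ≡ x) × (y' ≡ suc y)

IsNEPath : (len : ℕ) → (Fin (suc len) → Point) → Set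
IsNEPath len S = ∀ (i : Fin len) → EastStep (S (inject₁ i)) (S (Fin.suc i)) ⊎ NorthStep (S (inject₁ i)) (S (Fin.suc i))

LiesAbove : (len : ℕ) → (Fin (suc len) → Point) → (Fin (suc len) → Point) → Set
LiesAbove len S₁ S₂ =
  ∀ (i j : Fin (suc len)) → 1 ≤ toℕ i → toℕ i ≤ len ∸ 1 → 1 ≤ toℕ j → toℕ j ≤ len ∸ 1 →
    proj₁ (S₁ i) ≡ proj₁ (S₂ j) → proj₂ (S₂ j) < proj₂ (S₁ i)

HasEastStepAt : (len : ℕ) → (Fin (suc len) → Point) → ℕ → ℕ → Set
HasEastStepAt len S p y = ∃[ i ] (S (inject₁ i) ≡ (p , y) × S (Fin.suc i) ≡ (suc p , y))

-- Cells of the region bounded above by S₁ and below by S₂: the cell with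
-- lower-left corner (p,q) lies in column [p,p+1], below the east step of S₁
-- in that column and above the east step of S₂ in that column.
ParallelogramCells : (len : ℕ) → (Fin (suc len) → Point) → (Fin (suc len) → Point) → CellSet
ParallelogramCells len S₁ S₂ (p , q) =
  ∃[ y₁ ] ∃[ y₂ ] (HasEastStepAt len S₁ p y₁ × HasEastStepAt len S₂ p y₂ × y₂ ≤ q × q < y₁)

record FrameData : Set where
  field
    m n len : ℕ
    S₁ S₂ : Fin (suc len) → Point
    S₁-path : IsNEPath len S₁
    S₂-path : IsNEPath len S₂
    start≡ : S₁ Fin.zero ≡ S₂ Fin.zero
    end≡ : S₁ (Fin.fromℕ len) ≡ S₂ (Fin.fromℕ len)
    above : LiesAbove len S₁ S₂
    1<a₀ : 1 < proj₁ (S₁ Fin.zero)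
    a₀<aₖ : proj₁ (S₁ Fin.zero) < proj₁ (S₁ (Fin.fromℕ len))
    aₖ<m : proj₁ (S₁ (Fin.fromℕ len)) < m
    1<b₀ : 1 < proj₂ (S₁ Fin.zero)
    b₀<bₖ : proj₂ (S₁ Fin.zero) < proj₂ (S₁ (Fin.fromℕ len))
    bₖ<n : proj₂ (S₁ (Fin.fromℕ len)) < n

InInterval : ℕ → ℕ → ℕ → ℕ → Cell → Set
InInterval i j k l (p , q) = i ≤ p × suc p ≤ k × j ≤ q × suc q ≤ l

FramePoly : FrameData → CellSet
FramePoly F c = InInterval 1 1 m n c × ¬ ParallelogramCells len S₁ S₂ c
  where open FrameData F

Attacking : CellSet → Cell → Cell → Set
Attacking P (p , q) (p' , q') =
  (p , q) ≢ (p' , q') ×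
  ( (q ≡ q' × (∀ r → (p ⊓ p') ≤ r → r ≤ (p ⊔ p') → P (r , q)))
  ⊎ (p ≡ p' × (∀ r → (q ⊓ q') ≤ r → r ≤ (q ⊔ q') → P (p , r))))

RookConfig : CellSet → (k : ℕ) → (Fin k → Cell) → Set
RookConfig P k C =
  (∀ a → P (C a)) ×
  (∀ a b → a ≢ b → C a ≢ C b × ¬ Attacking P (C a) (C b))

InnerInterval : CellSet → ℕ → ℕ → ℕ → ℕ → Set
InnerInterval P i j k l = i < k × j < l × (∀ c → InInterval i j k l c → P c)

SamePair : Cell → Cell → Cell → Cell → Set
SamePair x y u v = (x ≡ u × y ≡ v) ⊎ (x ≡ v × y ≡ u)

-- diagonal cells of P_J: those containing (i,j) and (k,l)
DiagCells : ℕ → ℕ → ℕ → ℕ → Cell → Cell → Set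
DiagCells i j k l A B = SamePair A B (i , j) (k ∸ 1 , l ∸ 1)

-- anti-diagonal cells of P_J: those containing (i,l) and (k,j)
AntiDiagCells : ℕ → ℕ → ℕ → ℕ → Cell → Cell → Set
AntiDiagCells i j k l A B = SamePair A B (i , l ∸ 1) (k ∸ 1 , j)

DiagonalPosition : CellSet → Cell → Cell → Set
DiagonalPosition P A B = ∃[ i ] ∃[ j ] ∃[ k ] ∃[ l ] (InnerInterval P i j k l × DiagCells i j k l A B)

AntiDiagonalPosition : CellSet → Cell → Cell → Set
AntiDiagonalPosition P A B = ∃[ i ] ∃[ j ] ∃[ k ] ∃[ l ] (InnerInterval P i j k l × AntiDiagCells i j k l A B)

Switching : CellSet → Cell → Cell → Set
Switching P A B = DiagonalPosition P A B ⊎ AntiDiagonalPosition P A B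

SwitchStep : CellSet → (k : ℕ) → (Fin k → Cell) → (Fin k → Cell) → Set
SwitchStep P k C C' =
  RookConfig P k C × RookConfig P k C' ×
  ∃[ a ] ∃[ b ] (a ≢ b × (∀ x → x ≢ a → x ≢ b → C' x ≡ C x) ×
    ∃[ i ] ∃[ j ] ∃[ k ] ∃[ l ] (InnerInterval P i j k l ×
      ((DiagCells i j k l (C a) (C b) × AntiDiagCells i j k l (C' a) (C' b))
      ⊎ (AntiDiagCells i j k l (C a) (C b) × DiagCells i j k l (C' a) (C' b)))))

Equiv : CellSet → (k : ℕ) → (Fin k → Cell) → (Fin k → Cell) → Set
Equiv P k C R = Star (SwitchStep P k) C R

{-# OPTIONS --safe #-}
module Submission where

-- Give the cell (x , y) the weight x y.  Switching two anti-diagonal rooks of an inner interval to its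
-- diagonal cells raises the total weight by (x₂ − x₁)(y₁ − y₂) > 0, and the result is again a rook
-- configuration: any other rook attacking a new corner would, along a side of the interval, already attack
-- one of the old rooks.  The total weight is bounded since the polyomino is finite, so switching
-- anti-diagonal pairs for as long as one exists terminates, in a configuration whose switching pairs are all
-- diagonal.

open import Defs
open import Data.Nat using (ℕ; zero; suc; _+_; _*_; _∸_; _≤_; _<_; _⊔_; _⊓_; z≤n; s≤s; _≤?_; _<?_)
open import Data.Nat.Properties
open import Data.Nat.Tactic.RingSolver using (solve-∀)
open import Data.Fin using (Fin; zero; suc; inject₁)
import Data.Fin.Properties as Finₚ
open import Data.Vec.Functional using (Vector; updateAt; removeAt)
open import Data.Vec.Functional.Properties using (updateAt-updates; updateAt-minimal)
open import Algebra.Properties.CommutativeMonoid.Sum +-0-commutativeMonoid using (sum; sum-remove; sum-cong-≗)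
open import Algebra.Properties.CommutativeSemigroup +-commutativeSemigroup using (xy∙z≈xz∙y; xy∙z≈zy∙x)
open import Data.Product using (Σ; Σ-syntax; ∃-syntax; _×_; _,_; proj₁; proj₂)
open import Data.Product.Properties using (≡-dec)
open import Data.Sum using (_⊎_; inj₁; inj₂)
open import Data.Empty using (⊥-elim)
open import Function using (_∘_; const)
open import Relation.Nullary using (¬_; Dec; yes; no)
open import Relation.Nullary.Decidable using (¬?; _×-dec_; _→-dec_; map′)
open import Relation.Binary.Construct.Closure.ReflexiveTransitive using (ε; _◅_)
open import Relation.Unary using (Decidable)
open import Relation.Binary.PropositionalEquality using (_≡_; _≢_; refl; sym; trans; cong; cong₂; subst; subst₂; module ≡-Reasoning)

AllBetween : (ℕ → Set) → ℕ → ℕ → Set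
AllBetween Q a b = ∀ r → a ⊓ b ≤ r → r ≤ a ⊔ b → Q r

module _ {Q : ℕ → Set} where

  allBetween-sym : ∀ {a b} → AllBetween Q a b → AllBetween Q b a
  allBetween-sym {a} {b} s r lo hi = s r (subst (_≤ r) (⊓-comm b a) lo) (subst (r ≤_) (⊔-comm b a) hi)

  allBetween-elim : ∀ {a b} → AllBetween Q a b → ∀ {r} → a ≤ r → r ≤ b → Q r
  allBetween-elim {a} {b} s {r} a≤r r≤b = s r (≤-trans (m⊓n≤m a b) a≤r) (≤-trans r≤b (m≤n⊔m a b))

  allBetween-intro : ∀ {a b} → a ≤ b → (∀ {r} → a ≤ r → r ≤ b → Q r) → AllBetween Q a b
  allBetween-intro a≤b q r lo hi = q (subst (_≤ r) (m≤n⇒m⊓n≡m a≤b) lo) (subst (r ≤_) (m≤n⇒m⊔n≡n a≤b) hi)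

  private
    allBetween-split : ∀ {a u b} → AllBetween Q a u → AllBetween Q u b → ∀ {r} → a ≤ r → r ≤ b → Q r
    allBetween-split {u = u} sau sub {r} a≤r r≤b with r ≤? u
    ... | yes r≤u = allBetween-elim sau a≤r r≤u
    ... | no r≰u = allBetween-elim sub (<⇒≤ (≰⇒> r≰u)) r≤b

  allBetween-trans : ∀ {a u b} → AllBetween Q a u → AllBetween Q u b → AllBetween Q a b
  allBetween-trans {a} {b = b} sau sub with ≤-total a b
  ... | inj₁ a≤b = allBetween-intro a≤b (allBetween-split sau sub)
  ... | inj₂ b≤a = allBetween-sym (allBetween-intro b≤a (allBetween-split (allBetween-sym sub) (allBetween-sym sau)))

rearrangement-< : ∀ {x₁ x₂ y₁ y₂} → x₁ < x₂ → y₂ < y₁ → x₁ * y₁ + x₂ * y₂ < x₁ * y₂ + x₂ * y₁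
rearrangement-< {x₁} {y₂ = y₂} x₁<x₂ y₂<y₁ with m≤n⇒∃[o]m+o≡n x₁<x₂ | m≤n⇒∃[o]m+o≡n y₂<y₁
... | d , refl | e , refl = subst (lhs <_) (expand x₁ y₂ d e) (m<m+n lhs (s≤s z≤n))
  where
  lhs : ℕ
  lhs = x₁ * suc (y₂ + e) + suc (x₁ + d) * y₂
  expand : ∀ x y d e → x * suc (y + e) + suc (x + d) * y + suc d * suc e ≡ x * y + suc (x + d) * suc (y + e)
  expand = solve-∀

sum-agree-except : ∀ {n} (f g : Vector ℕ n) i → (∀ x → x ≢ i → g x ≡ f x) → sum f + g i ≡ sum g + f i
sum-agree-except {suc n} f g i agree = begin
  sum f + g i               ≡⟨ cong (_+ g i) (sum-remove {i = i} f) ⟩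
  f i + rest f + g i        ≡⟨ cong (λ s → f i + s + g i) (sum-cong-≗ (λ j → sym (agree _ (Finₚ.punchInᵢ≢i i j)))) ⟩
  f i + rest g + g i        ≡⟨ xy∙z≈zy∙x (f i) (rest g) (g i) ⟩
  g i + rest g + f i        ≡⟨ cong (_+ f i) (sym (sum-remove {i = i} g)) ⟩
  sum g + f i               ∎
  where
  open ≡-Reasoning
  rest : Vector ℕ (suc n) → ℕ
  rest h = sum (removeAt h i)

sum-agree-except₂ : ∀ {n} (f g : Vector ℕ n) {a b} → a ≢ b → (∀ x → x ≢ a → x ≢ b → g x ≡ f x) →
  sum f + (g a + g b) ≡ sum g + (f a + f b)
sum-agree-except₂ f g {a} {b} a≢b agree = begin
  sum f + (g a + g b)     ≡⟨ sym (+-assoc (sum f) (g a) (g b)) ⟩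
  sum f + g a + g b       ≡⟨ cong (λ v → sum f + v + g b) (sym (updateAt-updates a f)) ⟩
  sum f + h a + g b       ≡⟨ cong (_+ g b) (sum-agree-except f h a (λ x → updateAt-minimal x a f)) ⟩
  sum h + f a + g b       ≡⟨ xy∙z≈xz∙y (sum h) (f a) (g b) ⟩
  sum h + g b + f a       ≡⟨ cong (_+ f a) (sum-agree-except h g b h≗g) ⟩
  sum g + h b + f a       ≡⟨ cong (λ v → sum g + v + f a) (updateAt-minimal b a f (a≢b ∘ sym)) ⟩
  sum g + f b + f a       ≡⟨ xy∙z≈xz∙y (sum g) (f b) (f a) ⟩
  sum g + f a + f b       ≡⟨ +-assoc (sum g) (f a) (f b) ⟩
  sum g + (f a + f b)     ∎
  where
  open ≡-Reasoning
  h : Vector ℕ _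
  h = updateAt f a (const (g a))
  h≗g : ∀ x → x ≢ b → g x ≡ h x
  h≗g x x≢b with x Finₚ.≟ a
  ... | yes refl = sym (updateAt-updates a f)
  ... | no x≢a = trans (agree x x≢a x≢b) (sym (updateAt-minimal x a f x≢a))

sum-≤ : ∀ {n M} (f : Vector ℕ n) → (∀ i → f i ≤ M) → sum f ≤ n * M
sum-≤ {zero} f f≤M = z≤n
sum-≤ {suc n} f f≤M = +-mono-≤ (f≤M zero) (sum-≤ (f ∘ suc) (f≤M ∘ suc))

weight : Cell → ℕ
weight (x , y) = x * y

potential : ∀ {k} → (Fin k → Cell) → ℕ
potential C = sum (weight ∘ C)

potential-<-replace₂ : ∀ {k} {C C' : Fin k → Cell} {a b} → a ≢ b → (∀ x → x ≢ a → x ≢ b → C' x ≡ C x) →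
  weight (C a) + weight (C b) < weight (C' a) + weight (C' b) → potential C < potential C'
potential-<-replace₂ {C = C} {C'} {a} {b} a≢b agree increase =
  +-cancelʳ-< (weight (C a) + weight (C b)) (potential C) (potential C') (begin-strict
    potential C + (weight (C a) + weight (C b))    <⟨ +-monoʳ-< (potential C) increase ⟩
    potential C + (weight (C' a) + weight (C' b))  ≡⟨ sum-agree-except₂ (weight ∘ C) (weight ∘ C') a≢b (λ x x≢a x≢b → cong weight (agree x x≢a x≢b)) ⟩
    potential C' + (weight (C a) + weight (C b))   ∎)
  where open ≤-Reasoning

module Rooks (P : CellSet) where

  NonAttacking : Cell → Cell → Set
  NonAttacking A B = A ≢ B × ¬ Attacking P A B

  attacking-sym : ∀ {A B} → Attacking P A B → Attacking P B A
  attacking-sym (A≢B , inj₁ (refl , s)) = A≢B ∘ sym , inj₁ (refl , allBetween-sym s)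
  attacking-sym (A≢B , inj₂ (refl , s)) = A≢B ∘ sym , inj₂ (refl , allBetween-sym s)

  nonAttacking-sym : ∀ {A B} → NonAttacking A B → NonAttacking B A
  nonAttacking-sym (A≢B , ¬AB) = A≢B ∘ sym , ¬AB ∘ attacking-sym

  nonAttacking-apart : ∀ {p q p' q'} → p ≢ p' → q ≢ q' → NonAttacking (p , q) (p' , q')
  nonAttacking-apart p≢p' q≢q' = p≢p' ∘ cong proj₁ , λ
    { (_ , inj₁ (q≡q' , _)) → q≢q' q≡q'
    ; (_ , inj₂ (p≡p' , _)) → p≢p' p≡p' }

  -- A rook attacking the corner (x , y) would, through the two segments, also attack (x , y') or (x' , y).
  nonAttacking-corner : ∀ {x y x' y' Z} → AllBetween (λ r → P (x , r)) y y' → AllBetween (λ r → P (r , y)) x x' →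
    NonAttacking Z (x , y') → NonAttacking Z (x' , y) → NonAttacking Z (x , y)
  nonAttacking-corner {x} {y} {Z = zx , zy} column row (Z≢U , ¬ZU) (Z≢V , ¬ZV) = Z≢N , ¬ZN
    where
    Z≢N : (zx , zy) ≢ (x , y)
    Z≢N refl = ¬ZU (Z≢U , inj₂ (refl , column))
    ¬ZN : ¬ Attacking P (zx , zy) (x , y)
    ¬ZN (_ , inj₁ (refl , s)) = ¬ZV (Z≢V , inj₁ (refl , allBetween-trans s row))
    ¬ZN (_ , inj₂ (refl , s)) = ¬ZU (Z≢U , inj₂ (refl , allBetween-trans s column))

  Rectangle : ℕ → ℕ → ℕ → ℕ → Set
  Rectangle x₁ y₁ x₂ y₂ = InnerInterval P x₁ y₁ (suc x₂) (suc y₂)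

  module _ {x₁ y₁ x₂ y₂} (J : Rectangle x₁ y₁ x₂ y₂) where

    rectangle-x≤ : x₁ ≤ x₂
    rectangle-x≤ = ≤-pred (proj₁ J)

    rectangle-y≤ : y₁ ≤ y₂
    rectangle-y≤ = ≤-pred (proj₁ (proj₂ J))

    rectangle-cell : ∀ {p q} → x₁ ≤ p → p ≤ x₂ → y₁ ≤ q → q ≤ y₂ → P (p , q)
    rectangle-cell x₁≤p p≤x₂ y₁≤q q≤y₂ = proj₂ (proj₂ J) _ (x₁≤p , s≤s p≤x₂ , y₁≤q , s≤s q≤y₂)

    rectangle-column : ∀ {p} → x₁ ≤ p → p ≤ x₂ → AllBetween (λ q → P (p , q)) y₁ y₂
    rectangle-column x₁≤p p≤x₂ = allBetween-intro rectangle-y≤ (rectangle-cell x₁≤p p≤x₂)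

    rectangle-row : ∀ {q} → y₁ ≤ q → q ≤ y₂ → AllBetween (λ p → P (p , q)) x₁ x₂
    rectangle-row y₁≤q q≤y₂ = allBetween-intro rectangle-x≤ (λ x₁≤p p≤x₂ → rectangle-cell x₁≤p p≤x₂ y₁≤q q≤y₂)

  antiDiagonal-strict : ∀ {x₁ y₁ x₂ y₂} → Rectangle x₁ y₂ x₂ y₁ → NonAttacking (x₁ , y₁) (x₂ , y₂) →
    x₁ < x₂ × y₂ < y₁
  antiDiagonal-strict {x₁} {y₁} {x₂} {y₂} J (A≢B , ¬AB) = ≤∧≢⇒< (rectangle-x≤ J) x₁≢x₂ , ≤∧≢⇒< (rectangle-y≤ J) y₂≢y₁
    where
    x₁≢x₂ : x₁ ≢ x₂
    x₁≢x₂ refl = ¬AB (A≢B , inj₂ (refl , allBetween-sym (rectangle-column J ≤-refl ≤-refl)))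
    y₂≢y₁ : y₂ ≢ y₁
    y₂≢y₁ refl = ¬AB (A≢B , inj₁ (refl , rectangle-row J ≤-refl ≤-refl))

  rookConfig-replace₂ : ∀ {k} {C C' : Fin k → Cell} {a b} → RookConfig P k C → a ≢ b →
    (∀ x → x ≢ a → x ≢ b → C' x ≡ C x) → P (C' a) → P (C' b) → NonAttacking (C' a) (C' b) →
    (∀ z → z ≢ a → z ≢ b → NonAttacking (C z) (C' a) × NonAttacking (C z) (C' b)) →
    RookConfig P k C'
  rookConfig-replace₂ {C = C} {C'} {a} {b} (C∈P , C-nonAttacking) a≢b same a∈P b∈P ab fresh =
    C'∈P , C'-nonAttacking
    where
    classify : ∀ x → x ≡ a ⊎ x ≡ b ⊎ (x ≢ a × x ≢ b)
    classify x with x Finₚ.≟ a | x Finₚ.≟ b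
    ... | yes x≡a | _       = inj₁ x≡a
    ... | no _    | yes x≡b = inj₂ (inj₁ x≡b)
    ... | no x≢a  | no x≢b  = inj₂ (inj₂ (x≢a , x≢b))

    stays : ∀ {x} → x ≢ a → x ≢ b → ∀ {B} → NonAttacking (C x) B → NonAttacking (C' x) B
    stays x≢a x≢b = subst (λ A → NonAttacking A _) (sym (same _ x≢a x≢b))

    C'∈P : ∀ x → P (C' x)
    C'∈P x with classify x
    ... | inj₁ refl = a∈P
    ... | inj₂ (inj₁ refl) = b∈P
    ... | inj₂ (inj₂ (x≢a , x≢b)) = subst P (sym (same x x≢a x≢b)) (C∈P x)

    C'-nonAttacking : ∀ x y → x ≢ y → NonAttacking (C' x) (C' y)
    C'-nonAttacking x y x≢y with classify x | classify y
    ... | inj₁ refl                | inj₁ refl                = ⊥-elim (x≢y refl)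
    ... | inj₁ refl                | inj₂ (inj₁ refl)         = ab
    ... | inj₁ refl                | inj₂ (inj₂ (y≢a , y≢b))  = nonAttacking-sym (stays y≢a y≢b (proj₁ (fresh y y≢a y≢b)))
    ... | inj₂ (inj₁ refl)         | inj₁ refl                = nonAttacking-sym ab
    ... | inj₂ (inj₁ refl)         | inj₂ (inj₁ refl)         = ⊥-elim (x≢y refl)
    ... | inj₂ (inj₁ refl)         | inj₂ (inj₂ (y≢a , y≢b))  = nonAttacking-sym (stays y≢a y≢b (proj₂ (fresh y y≢a y≢b)))
    ... | inj₂ (inj₂ (x≢a , x≢b))  | inj₁ refl                = stays x≢a x≢b (proj₁ (fresh x x≢a x≢b))
    ... | inj₂ (inj₂ (x≢a , x≢b))  | inj₂ (inj₁ refl)         = stays x≢a x≢b (proj₂ (fresh x x≢a x≢b))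
    ... | inj₂ (inj₂ (x≢a , x≢b))  | inj₂ (inj₂ (y≢a , y≢b))  =
      nonAttacking-sym (stays y≢a y≢b (nonAttacking-sym (stays x≢a x≢b (C-nonAttacking x y x≢y))))

  switch-antiDiagonal : ∀ {k} {C : Fin k → Cell} {a b x₁ y₁ x₂ y₂} → RookConfig P k C → a ≢ b →
    C a ≡ (x₁ , y₁) → C b ≡ (x₂ , y₂) → Rectangle x₁ y₂ x₂ y₁ →
    Σ[ C' ∈ (Fin k → Cell) ] (SwitchStep P k C' C × potential C < potential C')
  switch-antiDiagonal {C = C} {a} {b} {x₁} {y₁} {x₂} {y₂} rc a≢b Ca Cb J =
    C' , (rc' , rc , a , b , a≢b , (λ x x≢a x≢b → sym (C'-same x x≢a x≢b)) ,
          x₁ , y₂ , suc x₂ , suc y₁ , J , inj₁ (inj₁ (C'a , C'b) , inj₁ (Ca , Cb))) ,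
    potential-<-replace₂ a≢b C'-same weight-increases
    where
    C' : Fin _ → Cell
    C' = updateAt (updateAt C a (const (x₁ , y₂))) b (const (x₂ , y₁))

    C'a : C' a ≡ (x₁ , y₂)
    C'a = trans (updateAt-minimal a b _ a≢b) (updateAt-updates a C)

    C'b : C' b ≡ (x₂ , y₁)
    C'b = updateAt-updates b _

    C'-same : ∀ x → x ≢ a → x ≢ b → C' x ≡ C x
    C'-same x x≢a x≢b = trans (updateAt-minimal x b _ x≢b) (updateAt-minimal x a C x≢a)

    x₁≤x₂ : x₁ ≤ x₂
    x₁≤x₂ = rectangle-x≤ J

    y₂≤y₁ : y₂ ≤ y₁
    y₂≤y₁ = rectangle-y≤ J

    separated : x₁ < x₂ × y₂ < y₁
    separated = antiDiagonal-strict J (subst₂ NonAttacking Ca Cb (proj₂ rc a b a≢b))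

    fresh : ∀ z → z ≢ a → z ≢ b → NonAttacking (C z) (C' a) × NonAttacking (C z) (C' b)
    fresh z z≢a z≢b =
      subst (NonAttacking (C z)) (sym C'a)
        (nonAttacking-corner (rectangle-column J ≤-refl x₁≤x₂) (rectangle-row J ≤-refl y₂≤y₁)
          (subst (NonAttacking (C z)) Ca (proj₂ rc z a z≢a)) (subst (NonAttacking (C z)) Cb (proj₂ rc z b z≢b))) ,
      subst (NonAttacking (C z)) (sym C'b)
        (nonAttacking-corner (allBetween-sym (rectangle-column J x₁≤x₂ ≤-refl)) (allBetween-sym (rectangle-row J y₂≤y₁ ≤-refl))
          (subst (NonAttacking (C z)) Cb (proj₂ rc z b z≢b)) (subst (NonAttacking (C z)) Ca (proj₂ rc z a z≢a)))

    rc' : RookConfig P _ C'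
    rc' = rookConfig-replace₂ rc a≢b C'-same
      (subst P (sym C'a) (rectangle-cell J ≤-refl x₁≤x₂ ≤-refl y₂≤y₁))
      (subst P (sym C'b) (rectangle-cell J x₁≤x₂ ≤-refl y₂≤y₁ ≤-refl))
      (subst₂ NonAttacking (sym C'a) (sym C'b)
        (nonAttacking-apart (<⇒≢ (proj₁ separated)) (<⇒≢ (proj₂ separated))))
      fresh

    weight-increases : weight (C a) + weight (C b) < weight (C' a) + weight (C' b)
    weight-increases = begin-strict
      weight (C a) + weight (C b)    ≡⟨ cong₂ _+_ (cong weight Ca) (cong weight Cb) ⟩
      x₁ * y₁ + x₂ * y₂              <⟨ rearrangement-< (proj₁ separated) (proj₂ separated) ⟩
      x₁ * y₂ + x₂ * y₁              ≡⟨ sym (cong₂ _+_ (cong weight C'a) (cong weight C'b)) ⟩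
      weight (C' a) + weight (C' b)  ∎
      where open ≤-Reasoning

  innerInterval⇒rectangle : ∀ {i j k l} → InnerInterval P i j k l → Rectangle i j (k ∸ 1) (l ∸ 1)
  innerInterval⇒rectangle {k = zero} (() , _)
  innerInterval⇒rectangle {k = suc _} {zero} (_ , () , _)
  innerInterval⇒rectangle {k = suc _} {suc _} J = J

  AllSwitchingDiagonal : (k : ℕ) → (Fin k → Cell) → Set
  AllSwitchingDiagonal k C = ∀ (a b : Fin k) → a ≢ b → Switching P (C a) (C b) → DiagonalPosition P (C a) (C b)

  antiDiagonalPosition⇒rectangle : ∀ {A B} → AntiDiagonalPosition P A B →
    Rectangle (proj₁ A) (proj₂ B) (proj₁ B) (proj₂ A) ⊎ Rectangle (proj₁ B) (proj₂ A) (proj₁ A) (proj₂ B)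
  antiDiagonalPosition⇒rectangle (i , j , k , l , J , inj₁ (refl , refl)) = inj₁ (innerInterval⇒rectangle J)
  antiDiagonalPosition⇒rectangle (i , j , k , l , J , inj₂ (refl , refl)) = inj₂ (innerInterval⇒rectangle J)

module Diagonalisation (P : CellSet) (P? : Decidable P) {m n : ℕ} (P-bounded : ∀ {p q} → P (p , q) → p < m × q < n) where
  open Rooks P

  innerInterval? : ∀ i j k l → Dec (InnerInterval P i j k l)
  innerInterval? i j k l = i <? k ×-dec j <? l ×-dec map′ to from
    (allUpTo? (λ p → allUpTo? (λ q → i ≤? p →-dec (j ≤? q →-dec P? (p , q))) l) k)
    where
    to : (∀ {p} → p < k → ∀ {q} → q < l → i ≤ p → j ≤ q → P (p , q)) → ∀ c → InInterval i j k l c → P c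
    to h _ (i≤p , p<k , j≤q , q<l) = h p<k q<l i≤p j≤q
    from : (∀ c → InInterval i j k l c → P c) → ∀ {p} → p < k → ∀ {q} → q < l → i ≤ p → j ≤ q → P (p , q)
    from h p<k q<l i≤p j≤q = h _ (i≤p , p<k , j≤q , q<l)

  AntiDiagonalPair : ∀ {k} → (Fin k → Cell) → Set
  AntiDiagonalPair C = ∃[ a ] ∃[ b ] (a ≢ b × Rectangle (proj₁ (C a)) (proj₂ (C b)) (proj₁ (C b)) (proj₂ (C a)))

  antiDiagonalPair? : ∀ {k} (C : Fin k → Cell) → Dec (AntiDiagonalPair C)
  antiDiagonalPair? C = Finₚ.any? λ a → Finₚ.any? λ b → ¬? (a Finₚ.≟ b) ×-dec innerInterval? _ _ _ _

  ¬antiDiagonalPair⇒allSwitchingDiagonal : ∀ {k} {C : Fin k → Cell} → ¬ AntiDiagonalPair C → AllSwitchingDiagonal k C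
  ¬antiDiagonalPair⇒allSwitchingDiagonal ¬pair a b a≢b (inj₁ diagonal) = diagonal
  ¬antiDiagonalPair⇒allSwitchingDiagonal ¬pair a b a≢b (inj₂ antiDiagonal)
    with antiDiagonalPosition⇒rectangle antiDiagonal
  ... | inj₁ J = ⊥-elim (¬pair (a , b , a≢b , J))
  ... | inj₂ J = ⊥-elim (¬pair (b , a , a≢b ∘ sym , J))

  potential-bounded : ∀ {k} {C : Fin k → Cell} → RookConfig P k C → potential C ≤ k * (m * n)
  potential-bounded (C∈P , _) = sum-≤ _ (λ x → weight-bounded (C∈P x))
    where
    weight-bounded : ∀ {c} → P c → weight c ≤ m * n
    weight-bounded c∈P = *-mono-≤ (<⇒≤ (proj₁ (P-bounded c∈P))) (<⇒≤ (proj₂ (P-bounded c∈P)))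

  Diagonalised : (k : ℕ) → (Fin k → Cell) → Set
  Diagonalised k R = Σ[ C ∈ (Fin k → Cell) ] (RookConfig P k C × Equiv P k C R × AllSwitchingDiagonal k C)

  -- Every switch raises the potential, which never exceeds k m n; fuel bounds the number of switches left.
  diagonalise-from : ∀ {k} {R : Fin k → Cell} fuel (C : Fin k → Cell) → RookConfig P k C → Equiv P k C R →
    k * (m * n) < potential C + fuel → Diagonalised k R
  diagonalise-from zero C rc C∼R bound<potential =
    ⊥-elim (<⇒≱ bound<potential (≤-trans (≤-reflexive (+-identityʳ (potential C))) (potential-bounded rc)))
  diagonalise-from (suc fuel) C rc C∼R bound<potential with antiDiagonalPair? C
  ... | no ¬pair = C , rc , C∼R , ¬antiDiagonalPair⇒allSwitchingDiagonal ¬pair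
  ... | yes (a , b , a≢b , J) with switch-antiDiagonal rc a≢b refl refl J
  ... | C' , step , increase = diagonalise-from fuel C' (proj₁ step) (step ◅ C∼R) (begin-strict
    _                         <⟨ bound<potential ⟩
    potential C + suc fuel    ≡⟨ +-suc (potential C) fuel ⟩
    suc (potential C) + fuel  ≤⟨ +-monoˡ-≤ fuel increase ⟩
    potential C' + fuel       ∎)
    where open ≤-Reasoning

  diagonalise : ∀ k (R : Fin k → Cell) → RookConfig P k R → Diagonalised k R
  diagonalise k R rc = diagonalise-from (suc (k * (m * n))) R rc ε (m≤n+m _ (potential R))

stepHeight : ∀ {len} → (Fin (suc len) → Point) → Fin len → ℕ
stepHeight S i = proj₂ (S (inject₁ i))

hasEastStepAt-stepHeight : ∀ {len} (S : Fin (suc len) → Point) {p y} → HasEastStepAt len S p y → ∃[ i ] (stepHeight S i ≡ y)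
hasEastStepAt-stepHeight S (i , S[i]≡py , _) = i , cong proj₂ S[i]≡py

hasEastStepAt? : ∀ len S p y → Dec (HasEastStepAt len S p y)
hasEastStepAt? len S p y =
  Finₚ.any? λ i → ≡-dec _≟_ _≟_ (S (inject₁ i)) (p , y) ×-dec ≡-dec _≟_ _≟_ (S (suc i)) (suc p , y)

-- The heights in ParallelogramCells range over ℕ, but only the finitely many step heights can occur.
parallelogramCells? : ∀ len S₁ S₂ → Decidable (ParallelogramCells len S₁ S₂)
parallelogramCells? len S₁ S₂ (p , q) = map′ from to (Finₚ.any? λ i → Finₚ.any? λ i' →
  hasEastStepAt? len S₁ p (stepHeight S₁ i) ×-dec hasEastStepAt? len S₂ p (stepHeight S₂ i') ×-dec
  stepHeight S₂ i' ≤? q ×-dec q <? stepHeight S₁ i)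
  where
  BetweenStepHeights : Set
  BetweenStepHeights = ∃[ i ] ∃[ i' ] (HasEastStepAt len S₁ p (stepHeight S₁ i) ×
    HasEastStepAt len S₂ p (stepHeight S₂ i') × stepHeight S₂ i' ≤ q × q < stepHeight S₁ i)
  from : BetweenStepHeights → ParallelogramCells len S₁ S₂ (p , q)
  from (i , i' , cell) = stepHeight S₁ i , stepHeight S₂ i' , cell
  to : ParallelogramCells len S₁ S₂ (p , q) → BetweenStepHeights
  to (y₁ , y₂ , step₁ , step₂ , y₂≤q , q<y₁) with hasEastStepAt-stepHeight S₁ step₁ | hasEastStepAt-stepHeight S₂ step₂
  ... | i , refl | i' , refl = i , i' , step₁ , step₂ , y₂≤q , q<y₁

framePoly? : ∀ F → Decidable (FramePoly F)
framePoly? F (p , q) =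
  (1 ≤? p ×-dec suc p ≤? m ×-dec 1 ≤? q ×-dec suc q ≤? n) ×-dec ¬? (parallelogramCells? len S₁ S₂ (p , q))
  where open FrameData F

framePoly-bounded : ∀ F {p q} → FramePoly F (p , q) → p < FrameData.m F × q < FrameData.n F
framePoly-bounded F ((_ , p<m , _ , q<n) , _) = p<m , q<n

proposition4p1 : (F : FrameData) (k : ℕ) (R : Fin k → Cell) →
    RookConfig (FramePoly F) k R →
    Σ (Fin k → Cell) (λ C →
      RookConfig (FramePoly F) k C × Equiv (FramePoly F) k C R ×
      (∀ (a b : Fin k) → a ≢ b → Switching (FramePoly F) (C a) (C b) →
        DiagonalPosition (FramePoly F) (C a) (C b)))
proposition4p1 F = Diagonalisation.diagonalise (FramePoly F) (framePoly? F) (framePoly-bounded F)
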